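{- Let $d \ge 1$ be an integer and let $\sigma \in \{0,1\}^{\mathbb{N}}$ be an infinite $01$-stream. Then $\sigma$ is eventually periodic if and only if the sequence of streams $(\Delta_d^n(\sigma))_{n=0}^{\infty} = \sigma, \Delta_d(\sigma), \Delta_d^2(\sigma), \ldots$ is eventually periodic, i.e. there exist $N \ge 0$ and $p \ge 1$ with $\Delta_d^{n+p}(\sigma) = \Delta_d^n(\sigma)$ for all $n \ge N$.
   Context: Streams are maps $\sigma : \mathbb{N} \to \{0,1\}$, written $\sigma(i)$. For $d \in \mathbb{N}$, the $(d{+}1)$-block difference operator $\Delta_d$ on streams is defined by $\Delta_d(\sigma)(i) = \sigma(i) + \sigma(i+1) + \cdots + \sigma(i+d)$, with addition modulo $2$, for all $i \in \mathbb{N}$; $\Delta_d^n$ denotes its $n$-fold iterate ($\Delta_d^0$ is the identity). The first difference operator is $\Delta = \Delta_1$. A stream $\tau$ is eventually periodic if there exist $N \ge 0$ and $p \ge 1$ with $\tau(i+p) = \tau(i)$ for all $i \ge N$. -}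

module Defs where

open import Data.Nat using (ℕ; zero; suc; _+_; _≤_; _≥_)
open import Data.Bool using (Bool; false; _xor_)
open import Data.Product using (∃; ∃-syntax; _×_)
open import Relation.Binary.PropositionalEquality using (_≡_)
open import Function using (_∘_)

-- A 01-stream is a map ℕ → {0,1}; we use Bool (false = 0, true = 1).
Stream : Set
Stream = ℕ → Bool

blockSum : Stream → ℕ → ℕ → Bool
blockSum σ i zero    = σ i
blockSum σ i (suc k) = blockSum σ i k xor σ (i + suc k)

Δ : ℕ → Stream → Stream
Δ d σ i = blockSum σ i d

Δ^ : ℕ → ℕ → Stream → Stream
Δ^ d zero    σ = σ
Δ^ d (suc n) σ = Δ d (Δ^ d n σ)

_≈ₛ_ : Stream → Stream → Set
σ ≈ₛ τ = ∀ i → σ i ≡ τ i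

EventuallyPeriodic : Stream → Set
EventuallyPeriodic τ = ∃[ N ] ∃[ p ] (p ≥ 1 × (∀ i → i ≥ N → τ (i + p) ≡ τ i))

IterEventuallyPeriodic : ℕ → Stream → Set
IterEventuallyPeriodic d σ =
  ∃[ N ] ∃[ p ] (p ≥ 1 × (∀ n → n ≥ N → Δ^ d (n + p) σ ≈ₛ Δ^ d n σ))

-- Both directions are pigeonhole arguments over finite windows.  Δ_d is a
-- sliding block code, so every Δ_d^n σ inherits the threshold N and period p of
-- σ; such streams are determined by their first N + p values, on which Δ_d acts
-- deterministically.  Conversely Δ_d^n is right-permutive of width nd: its value
-- at i and σ(i), …, σ(i + nd − 1) determine σ(i + nd).  If Δ_d^{N+p} σ = Δ_d^N σ,
-- put M = (N + p)d; since Nd < M, the value Δ_d^{N+p} σ (i) = Δ_d^N σ (i) depends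
-- only on σ(i), …, σ(i + M − 1), hence so does σ(i + M), and the windows of
-- length M evolve deterministically.
module Submission where

open import Defs
open import Data.Nat using (ℕ; zero; suc; _+_; _*_; _∸_; _^_; _≤_; _<_; _>_; _≥_; z≤n; s≤s; z<s; >-nonZero)
open import Data.Nat.Properties
open import Data.Nat.Induction using (<-rec)
open import Algebra.Properties.CommutativeSemigroup +-commutativeSemigroup using (xy∙z≈xz∙y)
open import Data.Bool using (true; false; _xor_)
open import Data.Bool.Properties using (not-injective)
open import Data.Fin using (Fin; toℕ; fromℕ<)
open import Data.Fin.Base using (funToFin; finToFun)
open import Data.Fin.Properties using (pigeonhole; toℕ-fromℕ<; finToFun-funToFin; 2↔Bool)
open import Data.Product using (∃-syntax; _×_; _,_)
open import Data.Sum using (inj₁; inj₂)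
open import Function using (_∘_)
open import Function.Bundles using (_⇔_; mk⇔; Inverse)
open import Relation.Binary.PropositionalEquality
  using (_≡_; refl; sym; trans; cong; cong₂; subst; subst₂; module ≡-Reasoning)
open import Relation.Nullary using (yes; no)

-- EventuallyPeriodic σ and IterEventuallyPeriodic d σ are both, definitionally,
-- instances of this notion for a relation on indices.
EventuallyRecurrent : (ℕ → ℕ → Set) → Set
EventuallyRecurrent _∼_ = ∃[ N ] ∃[ p ] (p ≥ 1 × (∀ n → n ≥ N → (n + p) ∼ n))

pigeonhole⇒eventuallyRecurrent : ∀ {m} (_∼_ : ℕ → ℕ → Set) (code : ℕ → Fin m) →
  (∀ a b → code a ≡ code b → a ∼ b) →
  (∀ a b → a ∼ b → suc a ∼ suc b) →
  EventuallyRecurrent _∼_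
pigeonhole⇒eventuallyRecurrent {m} _∼_ code sameCode step
  with i , j , i<j , codeEq ← pigeonhole (n<1+n m) (code ∘ toℕ)
  = a , b ∸ a , m<n⇒0<n∸m i<j , recur
  where
  a b : ℕ
  a = toℕ i
  b = toℕ j

  shift : ∀ t → (t + b) ∼ (t + a)
  shift zero    = sameCode _ _ (sym codeEq)
  shift (suc t) = step _ _ (shift t)

  recur : ∀ n → n ≥ a → (n + (b ∸ a)) ∼ n
  recur n n≥a = subst₂ _∼_ shifted (m∸n+n≡m n≥a) (shift (n ∸ a))
    where
    open ≡-Reasoning
    shifted : n ∸ a + b ≡ n + (b ∸ a)
    shifted = begin
      n ∸ a + b              ≡⟨ cong (n ∸ a +_) (sym (m+[n∸m]≡n (<⇒≤ i<j))) ⟩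
      n ∸ a + (a + (b ∸ a))  ≡⟨ sym (+-assoc (n ∸ a) a (b ∸ a)) ⟩
      n ∸ a + a + (b ∸ a)    ≡⟨ cong (_+ (b ∸ a)) (m∸n+n≡m n≥a) ⟩
      n + (b ∸ a)            ∎

record Agree (k : ℕ) (τ : Stream) (i : ℕ) (τ' : Stream) (i' : ℕ) : Set where
  constructor mkAgree
  field at : ∀ j → j < k → τ (i + j) ≡ τ' (i' + j)

open Agree

module _ {τ τ' : Stream} {i i' : ℕ} where

  Agree-head : ∀ {k} → k > 0 → Agree k τ i τ' i' → τ i ≡ τ' i'
  Agree-head k>0 agree =
    subst₂ (λ a a' → τ a ≡ τ' a') (+-identityʳ i) (+-identityʳ i') (at agree 0 k>0)

  Agree-weaken : ∀ {k l} → k ≤ l → Agree l τ i τ' i' → Agree k τ i τ' i'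
  Agree-weaken k≤l agree = mkAgree λ j j<k → at agree j (<-≤-trans j<k k≤l)

  Agree-shift : ∀ {s k l} → s + k ≤ l → Agree l τ i τ' i' → Agree k τ (i + s) τ' (i' + s)
  Agree-shift {s} s+k≤l agree = mkAgree λ j j<k →
    subst₂ (λ a a' → τ a ≡ τ' a') (sym (+-assoc i s j)) (sym (+-assoc i' s j))
      (at agree (s + j) (<-≤-trans (+-monoʳ-< s j<k) s+k≤l))

  Agree-snoc : ∀ {k} → Agree k τ i τ' i' → τ (i + k) ≡ τ' (i' + k) → Agree (suc k) τ i τ' i'
  Agree-snoc {k} agree last = mkAgree extended
    where
    extended : ∀ j → j < suc k → τ (i + j) ≡ τ' (i' + j)
    extended j j<1+k with m<1+n⇒m<n∨m≡n j<1+k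
    ... | inj₁ j<k  = at agree j j<k
    ... | inj₂ refl = last

  Agree-suc : ∀ {k} → Agree (suc k) τ i τ' i' → Agree k τ (suc i) τ' (suc i')
  Agree-suc agree = mkAgree λ j j<k →
    subst₂ (λ a a' → τ a ≡ τ' a') (+-suc i j) (+-suc i' j) (at agree (suc j) (s≤s j<k))

windowCode : (k : ℕ) → Stream → ℕ → Fin (2 ^ k)
windowCode k τ i = funToFin (λ (j : Fin k) → Inverse.from 2↔Bool (τ (i + toℕ j)))

windowCode-injective : ∀ k τ i τ' i' → windowCode k τ i ≡ windowCode k τ' i' → Agree k τ i τ' i'
windowCode-injective k τ i τ' i' codeEq = mkAgree agreeAt
  where
  open Inverse 2↔Bool using (from; to; strictlyInverseˡ)

  bitCode-injective : ∀ {x y} → from x ≡ from y → x ≡ y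
  bitCode-injective {x} {y} eq = trans (sym (strictlyInverseˡ x)) (trans (cong to eq) (strictlyInverseˡ y))

  digitEq : ∀ J → from (τ (i + toℕ J)) ≡ from (τ' (i' + toℕ J))
  digitEq J = begin
    from (τ (i + toℕ J))             ≡⟨ finToFun-funToFin (λ (j : Fin k) → from (τ (i + toℕ j))) J ⟨
    finToFun (windowCode k τ i) J    ≡⟨ cong (λ c → finToFun c J) codeEq ⟩
    finToFun (windowCode k τ' i') J  ≡⟨ finToFun-funToFin (λ (j : Fin k) → from (τ' (i' + toℕ j))) J ⟩
    from (τ' (i' + toℕ J))           ∎
    where open ≡-Reasoning

  agreeAt : ∀ j → j < k → τ (i + j) ≡ τ' (i' + j)
  agreeAt j j<k = subst (λ t → τ (i + t) ≡ τ' (i' + t)) (toℕ-fromℕ< j<k)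
    (bitCode-injective (digitEq (fromℕ< j<k)))

-- The window has length k + 1, so that Δ d and Δ^ d n get width d and n * d.
SlidingBlock : ℕ → (Stream → Stream) → Set
SlidingBlock k G = ∀ τ i τ' i' → Agree (suc k) τ i τ' i' → G τ i ≡ G τ' i'

RightPermutive : ℕ → (Stream → Stream) → Set
RightPermutive k G = ∀ τ i τ' i' → Agree k τ i τ' i' → G τ i ≡ G τ' i' → τ (i + k) ≡ τ' (i' + k)

id-slidingBlock : SlidingBlock 0 (λ τ → τ)
id-slidingBlock τ i τ' i' = Agree-head z<s

id-rightPermutive : RightPermutive 0 (λ τ → τ)
id-rightPermutive τ i τ' i' _ eq =
  subst₂ (λ a a' → τ a ≡ τ' a') (sym (+-identityʳ i)) (sym (+-identityʳ i')) eq

slidingBlock-∘ : ∀ {s r G F} → SlidingBlock s G → SlidingBlock r F → SlidingBlock (s + r) (G ∘ F)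
slidingBlock-∘ {s} {r} {G} {F} G-block F-block τ i τ' i' agree =
  G-block (F τ) i (F τ') i' (mkAgree λ j j≤s → F-block τ (i + j) τ' (i' + j) (Agree-shift (fits j≤s) agree))
  where
  fits : ∀ {j} → j < suc s → j + suc r ≤ suc (s + r)
  fits j≤s = ≤-trans (+-monoˡ-≤ (suc r) (m<1+n⇒m≤n j≤s)) (≤-reflexive (+-suc s r))

rightPermutive-∘ : ∀ {s r G F} → RightPermutive s G → SlidingBlock r F → RightPermutive r F →
  RightPermutive (s + r) (G ∘ F)
rightPermutive-∘ {s} {r} {G} {F} G-perm F-block F-perm τ i τ' i' agree eq =
  subst₂ (λ a a' → τ a ≡ τ' a') (+-assoc i s r) (+-assoc i' s r)
    (F-perm τ (i + s) τ' (i' + s) (Agree-shift ≤-refl agree) (G-perm (F τ) i (F τ') i' F-agree eq))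
  where
  F-agree : Agree s (F τ) i (F τ') i'
  F-agree = mkAgree λ j j<s → F-block τ (i + j) τ' (i' + j) (Agree-shift (fits j<s) agree)
    where
    fits : ∀ {j} → j < s → j + suc r ≤ s + r
    fits {j} j<s = ≤-trans (≤-reflexive (+-suc j r)) (+-monoˡ-< r j<s)

xor-injectiveʳ : ∀ x {y z} → x xor y ≡ x xor z → y ≡ z
xor-injectiveʳ true  = not-injective
xor-injectiveʳ false eq = eq

Δ-slidingBlock : ∀ d → SlidingBlock d (Δ d)
Δ-slidingBlock zero    = id-slidingBlock
Δ-slidingBlock (suc d) τ i τ' i' agree =
  cong₂ _xor_ (Δ-slidingBlock d τ i τ' i' (Agree-weaken (n≤1+n _) agree)) (at agree (suc d) ≤-refl)

Δ-rightPermutive : ∀ d → RightPermutive d (Δ d)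
Δ-rightPermutive zero    = id-rightPermutive
Δ-rightPermutive (suc d) τ i τ' i' agree eq =
  xor-injectiveʳ (Δ d τ' i') (trans (cong (_xor τ (i + suc d)) (sym sameBlock)) eq)
  where
  sameBlock : Δ d τ i ≡ Δ d τ' i'
  sameBlock = Δ-slidingBlock d τ i τ' i' agree

Δ^-slidingBlock : ∀ d n → SlidingBlock (n * d) (Δ^ d n)
Δ^-slidingBlock d zero    = id-slidingBlock
Δ^-slidingBlock d (suc n) = slidingBlock-∘ (Δ-slidingBlock d) (Δ^-slidingBlock d n)

Δ^-rightPermutive : ∀ d n → RightPermutive (n * d) (Δ^ d n)
Δ^-rightPermutive d zero    = id-rightPermutive
Δ^-rightPermutive d (suc n) =
  rightPermutive-∘ (Δ-rightPermutive d) (Δ^-slidingBlock d n) (Δ^-rightPermutive d n)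

PeriodicFrom : ℕ → ℕ → Stream → Set
PeriodicFrom N p τ = ∀ i → i ≥ N → τ (i + p) ≡ τ i

slidingBlock-periodicFrom : ∀ {k G N p τ} → SlidingBlock k G → PeriodicFrom N p τ → PeriodicFrom N p (G τ)
slidingBlock-periodicFrom {p = p} {τ} G-block periodic i i≥N =
  G-block τ (i + p) τ i (mkAgree λ j _ →
    trans (cong τ (xy∙z≈xz∙y i p j)) (periodic (i + j) (≤-trans i≥N (m≤m+n i j))))

periodicFrom-ext : ∀ {N p τ τ'} → p ≥ 1 → PeriodicFrom N p τ → PeriodicFrom N p τ' →
  Agree (N + p) τ 0 τ' 0 → τ ≈ₛ τ'
periodicFrom-ext {N} {p} {τ} {τ'} p≥1 periodic periodic' agree = <-rec (λ i → τ i ≡ τ' i) go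
  where
  go : ∀ i → (∀ {k} → k < i → τ k ≡ τ' k) → τ i ≡ τ' i
  go i below with i <? N + p
  ... | yes i<N+p = at agree i i<N+p
  ... | no  i≮N+p = subst (λ t → τ t ≡ τ' t) k+p≡i
                      (trans (periodic k k≥N) (trans (below k<i) (sym (periodic' k k≥N))))
    where
    N+p≤i : N + p ≤ i
    N+p≤i = ≮⇒≥ i≮N+p
    k : ℕ
    k = i ∸ p
    k+p≡i : k + p ≡ i
    k+p≡i = m∸n+n≡m (≤-trans (m≤n+m p N) N+p≤i)
    k≥N : k ≥ N
    k≥N = m+n≤o⇒m≤o∸n N N+p≤i
    k<i : k < i
    k<i = subst (k <_) k+p≡i (m<m+n k p≥1)

eventuallyPeriodic⇒iterates : ∀ d σ → EventuallyPeriodic σ → IterEventuallyPeriodic d σ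
eventuallyPeriodic⇒iterates d σ (N , p , p≥1 , periodic) =
  pigeonhole⇒eventuallyRecurrent (λ a b → Δ^ d a σ ≈ₛ Δ^ d b σ)
    (λ n → windowCode (N + p) (Δ^ d n σ) 0) sameCode step
  where
  iterate-periodicFrom : ∀ n → PeriodicFrom N p (Δ^ d n σ)
  iterate-periodicFrom zero    = periodic
  iterate-periodicFrom (suc n) = slidingBlock-periodicFrom (Δ-slidingBlock d) (iterate-periodicFrom n)

  sameCode : ∀ a b → windowCode (N + p) (Δ^ d a σ) 0 ≡ windowCode (N + p) (Δ^ d b σ) 0 →
    Δ^ d a σ ≈ₛ Δ^ d b σ
  sameCode a b codeEq = periodicFrom-ext p≥1 (iterate-periodicFrom a) (iterate-periodicFrom b)
    (windowCode-injective (N + p) (Δ^ d a σ) 0 (Δ^ d b σ) 0 codeEq)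

  step : ∀ a b → Δ^ d a σ ≈ₛ Δ^ d b σ → Δ^ d (suc a) σ ≈ₛ Δ^ d (suc b) σ
  step a b eq i = Δ-slidingBlock d (Δ^ d a σ) i (Δ^ d b σ) i (mkAgree λ j _ → eq (i + j))

windowsRecurrent⇒eventuallyPeriodic : ∀ {M σ} → M > 0 →
  EventuallyRecurrent (λ a b → Agree M σ a σ b) → EventuallyPeriodic σ
windowsRecurrent⇒eventuallyPeriodic M>0 (K , q , q≥1 , recur) =
  K , q , q≥1 , λ n n≥K → Agree-head M>0 (recur n n≥K)

iterates⇒eventuallyPeriodic : ∀ d → d ≥ 1 → ∀ σ → IterEventuallyPeriodic d σ → EventuallyPeriodic σ
iterates⇒eventuallyPeriodic d d≥1 σ (N , p , p≥1 , iterPeriodic) =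
  windowsRecurrent⇒eventuallyPeriodic (≤-<-trans z≤n Nd<M)
    (pigeonhole⇒eventuallyRecurrent (λ a b → Agree M σ a σ b) (windowCode M σ)
      (λ a b → windowCode-injective M σ a σ b) step)
  where
  M : ℕ
  M = (N + p) * d
  Nd<M : N * d < M
  Nd<M = *-monoˡ-< d {{>-nonZero d≥1}} (m<m+n N p≥1)

  step : ∀ a b → Agree M σ a σ b → Agree M σ (suc a) σ (suc b)
  step a b agree = Agree-suc (Agree-snoc agree (Δ^-rightPermutive d (N + p) σ a σ b agree sameTop))
    where
    sameTop : Δ^ d (N + p) σ a ≡ Δ^ d (N + p) σ b
    sameTop = begin
      Δ^ d (N + p) σ a  ≡⟨ iterPeriodic N ≤-refl a ⟩
      Δ^ d N σ a        ≡⟨ Δ^-slidingBlock d N σ a σ b (Agree-weaken Nd<M agree) ⟩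
      Δ^ d N σ b        ≡⟨ iterPeriodic N ≤-refl b ⟨
      Δ^ d (N + p) σ b  ∎
      where open ≡-Reasoning

mainTheorem1 : (d : ℕ) → d ≥ 1 → (σ : Stream) →
    EventuallyPeriodic σ ⇔ IterEventuallyPeriodic d σ
mainTheorem1 d d≥1 σ = mk⇔ (eventuallyPeriodic⇒iterates d σ) (iterates⇒eventuallyPeriodic d d≥1 σ)
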